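{- There exists an atomless Boolean contact algebra satisfying (IA) $x\ll y\to\exists z\,(x\ll z\ll y)$, (C5) $\forall x\neq\mathsf{0}\,\exists y\neq\mathsf{0}\; y\ll x$, and $\mathbf{Q}_W\subseteq\mathbf{Q}_G$, which does not satisfy (C6) $x\notin\{\mathsf{0},\mathsf{1}\}\to x\mathrel{\mathsf{C}} -x$.
   Context: A Boolean contact algebra is a Boolean algebra $\langle B,\cdot,+,-,\mathsf{0},\mathsf{1}\rangle$ with a relation $\mathsf{C}$ satisfying (C0) $\neg(\mathsf{0}\mathrel{\mathsf{C}} x)$; (C1) $x\leq y\wedge x\neq\mathsf{0}\to x\mathrel{\mathsf{C}} y$; (C2) symmetry; (C3) $x\leq y\to\forall z(z\mathrel{\mathsf{C}} x\to z\mathrel{\mathsf{C}} y)$; (C4) $x\mathrel{\mathsf{C}}(y+z)\to x\mathrel{\mathsf{C}} y\vee x\mathrel{\mathsf{C}} z$. $x\ll y$ iff $\neg(x\mathrel{\mathsf{C}} -y)$; $x\mathrel{\mathsf{O}} y$ iff $x\cdot y\neq\mathsf{0}$. $X\trianglelefteq Y$ means: for every $y\in Y$ there is $x\in X$ with $x\leq y$. $\mathbf{Q}_G$: G-representatives, non-empty $Q\subseteq B$ with (r0) $\mathsf{0}\notin Q$; (r1) for $u,v\in Q$: $u=v$ or $u\ll v$ or $v\ll u$; (r2) every $u\in Q$ has $v\in Q$ with $v\ll u$; (r3) if every $u\in Q$ overlaps both $x$ and $y$ then $x\mathrel{\mathsf{C}} y$. Abstractive set: $A\subseteq B$ with (r0),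 (r1) and no non-zero $x$ below all elements of $A$. $\mathbf{Q}_W$: abstractive sets $A$ such that for every abstractive $D$, $D\trianglelefteq A$ implies $A\trianglelefteq D$. -}

module Defs where

open import Level using (0ℓ)
open import Algebra.Lattice.Bundles using (BooleanAlgebra)
open import Relation.Binary.Core using (Rel)
open import Relation.Unary using (Pred; _∈_; _⊆_)
open import Relation.Nullary using (¬_)
open import Data.Product using (Σ; ∃; _×_; _,_)
open import Data.Sum using (_⊎_)

module Contact (B : BooleanAlgebra 0ℓ 0ℓ) (C : Rel (BooleanAlgebra.Carrier B) 0ℓ) where
  open BooleanAlgebra B renaming (_∧_ to _·_; _∨_ to _+_; ¬_ to -_; ⊥ to 𝟘; ⊤ to 𝟙)

  _≤_ : Rel Carrier 0ℓ
  x ≤ y = (x · y) ≈ x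

  _≪_ : Rel Carrier 0ℓ
  x ≪ y = ¬ C x (- y)

  O : Rel Carrier 0ℓ
  O x y = ¬ ((x · y) ≈ 𝟘)

  record IsBCA : Set where
    field
      C0 : ∀ x → ¬ C 𝟘 x
      C1 : ∀ x y → x ≤ y → ¬ (x ≈ 𝟘) → C x y
      C2 : ∀ x y → C x y → C y x
      C3 : ∀ x y → x ≤ y → ∀ z → C z x → C z y
      C4 : ∀ x y z → C x (y + z) → C x y ⊎ C x z

  Atomless : Set
  Atomless = ∀ x → ¬ (x ≈ 𝟘) → ∃ λ y → ¬ (y ≈ 𝟘) × y ≤ x × ¬ (y ≈ x)

  IA : Set
  IA = ∀ x y → x ≪ y → ∃ λ z → x ≪ z × z ≪ y

  C5 : Set
  C5 = ∀ x → ¬ (x ≈ 𝟘) → ∃ λ y → ¬ (y ≈ 𝟘) × y ≪ x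

  C6 : Set
  C6 = ∀ x → ¬ (x ≈ 𝟘) → ¬ (x ≈ 𝟙) → C x (- x)

  _⊴_ : Pred Carrier 0ℓ → Pred Carrier 0ℓ → Set
  X ⊴ Y = ∀ y → y ∈ Y → ∃ λ x → x ∈ X × x ≤ y

  r0 : Pred Carrier 0ℓ → Set
  r0 Q = ∀ u → u ∈ Q → ¬ (u ≈ 𝟘)

  r1 : Pred Carrier 0ℓ → Set
  r1 Q = ∀ u v → u ∈ Q → v ∈ Q → u ≈ v ⊎ (u ≪ v ⊎ v ≪ u)

  r2 : Pred Carrier 0ℓ → Set
  r2 Q = ∀ u → u ∈ Q → ∃ λ v → v ∈ Q × v ≪ u

  r3 : Pred Carrier 0ℓ → Set
  r3 Q = ∀ x y → (∀ u → u ∈ Q → O u x × O u y) → C x y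

  IsGRep : Pred Carrier 0ℓ → Set
  IsGRep Q = (∃ λ u → u ∈ Q) × r0 Q × r1 Q × r2 Q × r3 Q

  IsAbstractive : Pred Carrier 0ℓ → Set
  IsAbstractive A = r0 A × r1 A × (∀ x → ¬ (x ≈ 𝟘) → ¬ (∀ a → a ∈ A → x ≤ a))

  IsWRep : Pred Carrier 0ℓ → Set₁
  IsWRep A = IsAbstractive A × (∀ (D : Pred Carrier 0ℓ) → IsAbstractive D → D ⊴ A → A ⊴ D)

  QW⊆QG : Set₁
  QW⊆QG = ∀ (A : Pred Carrier 0ℓ) → IsWRep A → IsGRep A

module Submission where

-- Take the clopen subsets of Cantor space with overlap, x · y ≉ 𝟘, as contact. Then x ≪ y is
-- (doubly negated) x ≤ y, so (IA) and (C5) hold trivially and (C6) fails at every element other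
-- than 𝟘 and 𝟙; such elements exist because the algebra is atomless: a clopen set is cut in two by
-- any coordinate beyond those it depends on. For 𝐐_W ⊆ 𝐐_G only non-emptiness and (r3) have
-- content. If x overlaps every member of a W-representative A, then {u · x | u ∈ A} is abstractive
-- and refines A, so by minimality some member of A lies below x (with x = 𝟙, via A ∪ {𝟙}, this
-- gives a member at all). Members of A below x and below y are comparable, and the smaller is a
-- non-zero lower bound of x · y.

open import Defs
open import Level using (0ℓ)
open import Algebra.Lattice.Bundles using (BooleanAlgebra)
import Algebra.Lattice.Properties.BooleanAlgebra as BooleanAlgebraProperties
import Relation.Binary.Lattice.Bundles as OrderLattice
import Relation.Binary.Reasoning.Setoid as SetoidReasoning
open import Relation.Binary.Core using (Rel)
open import Relation.Nullary using (¬_; Dec; yes; no)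
open import Relation.Nullary.Negation using (¬¬-map)
open import Relation.Unary using (Pred; _∈_)
open import Data.Product using (Σ; ∃; _×_; _,_; proj₁; proj₂)
open import Data.Sum using (_⊎_; inj₁; inj₂)
open import Data.Empty using (⊥-elim)
open import Data.Bool using (Bool; true; false; not; _∧_; _∨_)
import Data.Bool.Properties as 𝔹
open import Data.Nat as ℕ using (ℕ; zero; suc; _<_; _⊔_; s≤s)
open import Data.Nat.Properties using (<-≤-trans; m≤m⊔n; m≤n⊔m; n<1+n)
open import Function using (_∘_; const)
import Relation.Binary.PropositionalEquality as ≡
open ≡ using (_≡_; _≢_)
open import Algebra.Lattice.Structures using (IsBooleanAlgebra)

module OverlapContact (B : BooleanAlgebra 0ℓ 0ℓ) where
  open BooleanAlgebra B renaming (_∧_ to _·_; _∨_ to _+_; ¬_ to -_; ⊥ to 𝟘; ⊤ to 𝟙)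
  open BooleanAlgebraProperties B using (∧-zeroˡ; ∧-zeroʳ; ∧-identityʳ; ∨-identityʳ; ∨-∧-orderTheoreticLattice)
  open SetoidReasoning setoid

  Overlap : Rel Carrier 0ℓ
  Overlap x y = ¬ (x · y ≈ 𝟘)

  open Contact B Overlap public

  -- The library orders a lattice by x ≈ x ∧ y, the symmetric form of _≤_ here.
  private
    module ≤ = OrderLattice.Lattice ∨-∧-orderTheoreticLattice

  ≈⇒≤ : ∀ {x y} → x ≈ y → x ≤ y
  ≈⇒≤ x≈y = sym (≤.reflexive x≈y)

  ≤-trans : ∀ {x y z} → x ≤ y → y ≤ z → x ≤ z
  ≤-trans x≤y y≤z = sym (≤.trans (sym x≤y) (sym y≤z))

  x·y≤x : ∀ x y → (x · y) ≤ x
  x·y≤x x y = sym (≤.x∧y≤x x y)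

  x·y≤y : ∀ x y → (x · y) ≤ y
  x·y≤y x y = sym (≤.x∧y≤y x y)

  ·-greatest : ∀ {x y z} → x ≤ y → x ≤ z → x ≤ (y · z)
  ·-greatest x≤y x≤z = sym (≤.∧-greatest (sym x≤y) (sym x≤z))

  ·-monoˡ-≤ : ∀ {x y} z → x ≤ y → (x · z) ≤ (y · z)
  ·-monoˡ-≤ {x} z x≤y = ·-greatest (≤-trans (x·y≤x x z) x≤y) (x·y≤y x z)

  ·-monoʳ-≤ : ∀ {x y} z → x ≤ y → (z · x) ≤ (z · y)
  ·-monoʳ-≤ {x} z x≤y = ·-greatest (x·y≤x z x) (≤-trans (x·y≤y z x) x≤y)

  ≤-≈𝟘 : ∀ {x y} → x ≤ y → y ≈ 𝟘 → x ≈ 𝟘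
  ≤-≈𝟘 {x} {y} x≤y y≈𝟘 = begin
    x      ≈⟨ sym x≤y ⟩
    x · y  ≈⟨ ∧-congˡ y≈𝟘 ⟩
    x · 𝟘  ≈⟨ ∧-zeroʳ x ⟩
    𝟘      ∎

  ≤⇒·-≈𝟘 : ∀ {x y} → x ≤ y → x · - y ≈ 𝟘
  ≤⇒·-≈𝟘 {x} {y} x≤y = begin
    x · - y        ≈⟨ ∧-congʳ (sym x≤y) ⟩
    (x · y) · - y  ≈⟨ ∧-assoc x y (- y) ⟩
    x · (y · - y)  ≈⟨ ∧-congˡ (∧-complementʳ y) ⟩
    x · 𝟘          ≈⟨ ∧-zeroʳ x ⟩
    𝟘              ∎

  ·-≈𝟘⇒≤ : ∀ {x y} → x · - y ≈ 𝟘 → x ≤ y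
  ·-≈𝟘⇒≤ {x} {y} x·-y≈𝟘 = begin
    x · y            ≈⟨ sym (∨-identityʳ (x · y)) ⟩
    x · y + 𝟘        ≈⟨ ∨-congˡ (sym x·-y≈𝟘) ⟩
    x · y + x · - y  ≈⟨ sym (∧-distribˡ-∨ x y (- y)) ⟩
    x · (y + - y)    ≈⟨ ∧-congˡ (∨-complementʳ y) ⟩
    x · 𝟙            ≈⟨ ∧-identityʳ x ⟩
    x                ∎

  ¬¬≤⇒≪ : ∀ {x y} → ¬ ¬ x ≤ y → x ≪ y
  ¬¬≤⇒≪ ¬¬x≤y x·-y≉𝟘 = ¬¬x≤y (λ x≤y → x·-y≉𝟘 (≤⇒·-≈𝟘 x≤y))

  ≪⇒¬¬≤ : ∀ {x y} → x ≪ y → ¬ ¬ x ≤ y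
  ≪⇒¬¬≤ x≪y ¬x≤y = x≪y (λ x·-y≈𝟘 → ¬x≤y (·-≈𝟘⇒≤ x·-y≈𝟘))

  ≪-map : ∀ {x y x′ y′} → (x ≤ y → x′ ≤ y′) → x ≪ y → x′ ≪ y′
  ≪-map f x≪y = ¬¬≤⇒≪ (¬¬-map f (≪⇒¬¬≤ x≪y))

  ≤⇒≪ : ∀ {x y} → x ≤ y → x ≪ y
  ≤⇒≪ x≤y = ¬¬≤⇒≪ (λ ¬x≤y → ¬x≤y x≤y)

  ≪-refl : ∀ x → x ≪ x
  ≪-refl x = ≤⇒≪ (≈⇒≤ refl)

  ≤-≈𝟙 : ∀ {x y} → y ≈ 𝟙 → x ≤ y
  ≤-≈𝟙 {x} y≈𝟙 = trans (∧-congˡ y≈𝟙) (∧-identityʳ x)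

  lowerBound⇒Overlap : ∀ {x y z} → ¬ z ≈ 𝟘 → z ≤ x → z ≤ y → Overlap x y
  lowerBound⇒Overlap z≉𝟘 z≤x z≤y x·y≈𝟘 = z≉𝟘 (≤-≈𝟘 (·-greatest z≤x z≤y) x·y≈𝟘)

  ·-distribˡ-≈𝟘 : ∀ {x y z} → x · y ≈ 𝟘 → x · z ≈ 𝟘 → x · (y + z) ≈ 𝟘
  ·-distribˡ-≈𝟘 {x} {y} {z} x·y≈𝟘 x·z≈𝟘 = begin
    x · (y + z)      ≈⟨ ∧-distribˡ-∨ x y z ⟩
    x · y + x · z    ≈⟨ ∨-cong x·y≈𝟘 x·z≈𝟘 ⟩
    𝟘 + 𝟘            ≈⟨ ∨-identityʳ 𝟘 ⟩
    𝟘                ∎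

  overlap-isBCA : (∀ x → Dec (x ≈ 𝟘)) → IsBCA
  overlap-isBCA ≈𝟘? = record
    { C0 = λ x 𝟘·x≉𝟘 → 𝟘·x≉𝟘 (∧-zeroˡ x)
    ; C1 = λ x y x≤y x≉𝟘 x·y≈𝟘 → x≉𝟘 (trans (sym x≤y) x·y≈𝟘)
    ; C2 = λ x y x·y≉𝟘 y·x≈𝟘 → x·y≉𝟘 (trans (∧-comm x y) y·x≈𝟘)
    ; C3 = λ x y x≤y z z·x≉𝟘 z·y≈𝟘 → z·x≉𝟘 (≤-≈𝟘 (·-monoʳ-≤ z x≤y) z·y≈𝟘)
    ; C4 = C4
    }
    where
    C4 : ∀ x y z → Overlap x (y + z) → Overlap x y ⊎ Overlap x z
    C4 x y z x·[y+z]≉𝟘 with ≈𝟘? (x · y) | ≈𝟘? (x · z)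
    ... | no x·y≉𝟘  | _          = inj₁ x·y≉𝟘
    ... | yes _     | no x·z≉𝟘   = inj₂ x·z≉𝟘
    ... | yes x·y≈𝟘 | yes x·z≈𝟘  = ⊥-elim (x·[y+z]≉𝟘 (·-distribˡ-≈𝟘 x·y≈𝟘 x·z≈𝟘))

  overlap-IA : IA
  overlap-IA x y x≪y = x , ≪-refl x , x≪y

  overlap-C5 : C5
  overlap-C5 x x≉𝟘 = x , x≉𝟘 , ≪-refl x

  atomless⇒¬C6 : ¬ 𝟙 ≈ 𝟘 → Atomless → ¬ C6
  atomless⇒¬C6 𝟙≉𝟘 atomless c6 with atomless 𝟙 𝟙≉𝟘
  ... | y , y≉𝟘 , _ , y≉𝟙 = c6 y y≉𝟘 y≉𝟙 (∧-complementʳ y)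

  _∪𝟙 : Pred Carrier 0ℓ → Pred Carrier 0ℓ
  (A ∪𝟙) x = x ∈ A ⊎ x ≈ 𝟙

  ∪𝟙-abstractive : ∀ {A} → ¬ 𝟙 ≈ 𝟘 → IsAbstractive A → IsAbstractive (A ∪𝟙)
  ∪𝟙-abstractive {A} 𝟙≉𝟘 (r0A , r1A , A-bounded) = r0′ , r1′ , λ x x≉𝟘 below-all →
    A-bounded x x≉𝟘 (λ a a∈A → below-all a (inj₁ a∈A))
    where
    r0′ : r0 (A ∪𝟙)
    r0′ u (inj₁ u∈A) = r0A u u∈A
    r0′ u (inj₂ u≈𝟙) u≈𝟘 = 𝟙≉𝟘 (trans (sym u≈𝟙) u≈𝟘)

    r1′ : r1 (A ∪𝟙)
    r1′ u v (inj₁ u∈A) (inj₁ v∈A) = r1A u v u∈A v∈A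
    r1′ u v (inj₁ _)   (inj₂ v≈𝟙) = inj₂ (inj₁ (≤⇒≪ (≤-≈𝟙 v≈𝟙)))
    r1′ u v (inj₂ u≈𝟙) (inj₁ _)   = inj₂ (inj₂ (≤⇒≪ (≤-≈𝟙 u≈𝟙)))
    r1′ u v (inj₂ u≈𝟙) (inj₂ v≈𝟙) = inj₁ (trans u≈𝟙 (sym v≈𝟙))

  _·ₛ_ : Pred Carrier 0ℓ → Carrier → Pred Carrier 0ℓ
  (A ·ₛ x) d = ∃ λ u → u ∈ A × d ≈ u · x

  ·ₛ-abstractive : ∀ {A x} → IsAbstractive A → (∀ u → u ∈ A → Overlap u x) →
                   IsAbstractive (A ·ₛ x)
  ·ₛ-abstractive {A} {x} (r0A , r1A , A-bounded) overlaps = r0′ , r1′ , λ z z≉𝟘 below-all →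
    A-bounded z z≉𝟘 (λ a a∈A → ≤-trans (below-all (a · x) (a , a∈A , refl)) (x·y≤x a x))
    where
    r0′ : r0 (A ·ₛ x)
    r0′ d (u , u∈A , d≈u·x) d≈𝟘 = overlaps u u∈A (trans (sym d≈u·x) d≈𝟘)

    cut : ∀ {d d′ u u′} → d ≈ u · x → d′ ≈ u′ · x → u ≤ u′ → d ≤ d′
    cut d≈u·x d′≈u′·x u≤u′ =
      ≤-trans (≈⇒≤ d≈u·x) (≤-trans (·-monoˡ-≤ x u≤u′) (≈⇒≤ (sym d′≈u′·x)))

    r1′ : r1 (A ·ₛ x)
    r1′ d d′ (u , u∈A , d≈u·x) (u′ , u′∈A , d′≈u′·x) with r1A u u′ u∈A u′∈A
    ... | inj₁ u≈u′         = inj₁ (trans d≈u·x (trans (∧-congʳ u≈u′) (sym d′≈u′·x)))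
    ... | inj₂ (inj₁ u≪u′) = inj₂ (inj₁ (≪-map (cut d≈u·x d′≈u′·x) u≪u′))
    ... | inj₂ (inj₂ u′≪u) = inj₂ (inj₂ (≪-map (cut d′≈u′·x d≈u·x) u′≪u))

  wRep-nonempty : ∀ {A} → ¬ 𝟙 ≈ 𝟘 → IsWRep A → ∃ λ u → u ∈ A
  wRep-nonempty {A} 𝟙≉𝟘 (A-abstractive , A-minimal)
    with A-minimal (A ∪𝟙) (∪𝟙-abstractive 𝟙≉𝟘 A-abstractive)
                   (λ y y∈A → y , inj₁ y∈A , ≈⇒≤ refl) 𝟙 (inj₂ refl)
  ... | u , u∈A , _ = u , u∈A

  wRep-below : ∀ {A x} → ¬ 𝟙 ≈ 𝟘 → IsWRep A → (∀ u → u ∈ A → Overlap u x) →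
               ∃ λ a → a ∈ A × a ≤ x
  wRep-below {A} {x} 𝟙≉𝟘 wA@(A-abstractive , A-minimal) overlaps with wRep-nonempty 𝟙≉𝟘 wA
  ... | u , u∈A with A-minimal (A ·ₛ x) (·ₛ-abstractive A-abstractive overlaps)
                               (λ y y∈A → y · x , (y , y∈A , refl) , x·y≤x y x) (u · x) (u , u∈A , refl)
  ...   | a , a∈A , a≤u·x = a , a∈A , ≤-trans a≤u·x (x·y≤y u x)

  wRep-r3 : ∀ {A} → ¬ 𝟙 ≈ 𝟘 → IsWRep A → r3 A
  wRep-r3 𝟙≉𝟘 wA@((r0A , r1A , _) , _) x y overlaps
    with wRep-below 𝟙≉𝟘 wA (λ u u∈A → proj₁ (overlaps u u∈A))
       | wRep-below 𝟙≉𝟘 wA (λ u u∈A → proj₂ (overlaps u u∈A))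
  ... | a , a∈A , a≤x | b , b∈A , b≤y with r1A a b a∈A b∈A
  ...   | inj₁ a≈b = lowerBound⇒Overlap (r0A a a∈A) a≤x (≤-trans (≈⇒≤ a≈b) b≤y)
  ...   | inj₂ (inj₁ a≪b) = λ x·y≈𝟘 → ≪⇒¬¬≤ a≪b λ a≤b →
    lowerBound⇒Overlap (r0A a a∈A) a≤x (≤-trans a≤b b≤y) x·y≈𝟘
  ...   | inj₂ (inj₂ b≪a) = λ x·y≈𝟘 → ≪⇒¬¬≤ b≪a λ b≤a →
    lowerBound⇒Overlap (r0A b b∈A) (≤-trans b≤a a≤x) b≤y x·y≈𝟘

  overlap-QW⊆QG : ¬ 𝟙 ≈ 𝟘 → QW⊆QG
  overlap-QW⊆QG 𝟙≉𝟘 _ wA@((r0A , r1A , _) , _) =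
    wRep-nonempty 𝟙≉𝟘 wA , r0A , r1A , (λ u u∈A → u , u∈A , ≪-refl u) , wRep-r3 𝟙≉𝟘 wA

module ClopenAlgebra where
  open ≡ using (refl; sym; trans; cong; cong₂)

  true≢false : true ≢ false
  true≢false ()

  Point : Set
  Point = ℕ → Bool

  AgreeBelow : ℕ → Point → Point → Set
  AgreeBelow n s t = ∀ {i} → i < n → s i ≡ t i

  Local : ℕ → (Point → Bool) → Set
  Local n f = ∀ {s t} → AgreeBelow n s t → f s ≡ f t

  Local-mono : ∀ {m n f} → m ℕ.≤ n → Local m f → Local n f
  Local-mono m≤n f-local agree = f-local (λ i<m → agree (<-≤-trans i<m m≤n))

  -- A clopen subset of Cantor space, as a membership test reading only the first modulus coordinates.
  record Clopen : Set where
    field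
      ⟦_⟧     : Point → Bool
      modulus : ℕ
      local   : Local modulus ⟦_⟧

  open Clopen

  pointwise : (Bool → Bool → Bool) → Clopen → Clopen → Clopen
  pointwise _∙_ x y = record
    { ⟦_⟧     = λ s → ⟦ x ⟧ s ∙ ⟦ y ⟧ s
    ; modulus = modulus x ⊔ modulus y
    ; local   = λ agree → cong₂ _∙_ (Local-mono (m≤m⊔n _ _) (local x) agree)
                                    (Local-mono (m≤n⊔m _ _) (local y) agree)
    }

  _∪_ _∩_ : Clopen → Clopen → Clopen
  _∪_ = pointwise _∨_
  _∩_ = pointwise _∧_

  ∁ : Clopen → Clopen
  ∁ x = record { ⟦_⟧ = not ∘ ⟦ x ⟧ ; modulus = modulus x ; local = cong not ∘ local x }

  constant : Bool → Clopen
  constant b = record { ⟦_⟧ = const b ; modulus = 0 ; local = λ _ → refl }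

  ∅ : Clopen
  ∅ = constant false

  _≐_ : Rel Clopen 0ℓ
  x ≐ y = ∀ s → ⟦ x ⟧ s ≡ ⟦ y ⟧ s

  clopen-isBooleanAlgebra : IsBooleanAlgebra _≐_ _∪_ _∩_ ∁ (constant true) ∅
  clopen-isBooleanAlgebra = record
    { isDistributiveLattice = record
      { isLattice = record
        { isEquivalence = record
          { refl  = λ _ → refl
          ; sym   = λ x≐y s → sym (x≐y s)
          ; trans = λ x≐y y≐z s → trans (x≐y s) (y≐z s)
          }
        ; ∨-comm     = λ x y s → 𝔹.∨-comm (⟦ x ⟧ s) (⟦ y ⟧ s)
        ; ∨-assoc    = λ x y z s → 𝔹.∨-assoc (⟦ x ⟧ s) (⟦ y ⟧ s) (⟦ z ⟧ s)
        ; ∨-cong     = λ x≐y u≐v s → cong₂ _∨_ (x≐y s) (u≐v s)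
        ; ∧-comm     = λ x y s → 𝔹.∧-comm (⟦ x ⟧ s) (⟦ y ⟧ s)
        ; ∧-assoc    = λ x y z s → 𝔹.∧-assoc (⟦ x ⟧ s) (⟦ y ⟧ s) (⟦ z ⟧ s)
        ; ∧-cong     = λ x≐y u≐v s → cong₂ _∧_ (x≐y s) (u≐v s)
        ; absorptive = (λ x y s → 𝔹.∨-abs-∧ (⟦ x ⟧ s) (⟦ y ⟧ s))
                     , (λ x y s → 𝔹.∧-abs-∨ (⟦ x ⟧ s) (⟦ y ⟧ s))
        }
      ; ∨-distrib-∧ = (λ x y z s → 𝔹.∨-distribˡ-∧ (⟦ x ⟧ s) (⟦ y ⟧ s) (⟦ z ⟧ s))
                    , (λ x y z s → 𝔹.∨-distribʳ-∧ (⟦ x ⟧ s) (⟦ y ⟧ s) (⟦ z ⟧ s))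
      ; ∧-distrib-∨ = (λ x y z s → 𝔹.∧-distribˡ-∨ (⟦ x ⟧ s) (⟦ y ⟧ s) (⟦ z ⟧ s))
                    , (λ x y z s → 𝔹.∧-distribʳ-∨ (⟦ x ⟧ s) (⟦ y ⟧ s) (⟦ z ⟧ s))
      }
    ; ∨-complement = (λ x s → 𝔹.∨-inverseˡ (⟦ x ⟧ s)) , (λ x s → 𝔹.∨-inverseʳ (⟦ x ⟧ s))
    ; ∧-complement = (λ x s → 𝔹.∧-inverseˡ (⟦ x ⟧ s)) , (λ x s → 𝔹.∧-inverseʳ (⟦ x ⟧ s))
    ; ¬-cong       = λ x≐y s → cong not (x≐y s)
    }

  CantorAlgebra : BooleanAlgebra 0ℓ 0ℓ
  CantorAlgebra = record { isBooleanAlgebra = clopen-isBooleanAlgebra }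

  open OverlapContact CantorAlgebra using (Atomless; x·y≤x)

  full≉∅ : ¬ constant true ≐ ∅
  full≉∅ full≐∅ = true≢false (full≐∅ (const false))

  _◂_ : Bool → Point → Point
  (b ◂ s) zero    = b
  (b ◂ s) (suc i) = s i

  ◂-η : ∀ s {i} → s i ≡ (s 0 ◂ (s ∘ suc)) i
  ◂-η s {zero}  = refl
  ◂-η s {suc i} = refl

  Local-◂ : ∀ {n f} b → Local (suc n) f → Local n (f ∘ (b ◂_))
  Local-◂ b f-local agree = f-local λ { {zero} _ → refl ; {suc i} (s≤s i<n) → agree i<n }

  search : ∀ n {f} → Local n f → (∀ s → f s ≡ false) ⊎ ∃ λ s → f s ≡ true
  search zero {f} f-local with f (const false) in eq
  ... | false = inj₁ λ s → trans (f-local λ ()) eq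
  ... | true  = inj₂ (const false , eq)
  search (suc n) {f} f-local with search n (Local-◂ false f-local) | search n (Local-◂ true f-local)
  ... | inj₂ (s , fs≡true) | _                  = inj₂ (false ◂ s , fs≡true)
  ... | inj₁ _             | inj₂ (s , fs≡true) = inj₂ (true ◂ s , fs≡true)
  ... | inj₁ f₀-empty      | inj₁ f₁-empty      =
    inj₁ λ s → trans (f-local (λ _ → ◂-η s)) (by-head (s 0) (s ∘ suc))
    where
    by-head : ∀ b t → f (b ◂ t) ≡ false
    by-head false = f₀-empty
    by-head true  = f₁-empty

  _≟∅ : ∀ x → Dec (x ≐ ∅)
  x ≟∅ with search (modulus x) (local x)
  ... | inj₁ x-empty   = yes x-empty
  ... | inj₂ (s , s∈x) = no λ x≐∅ → true≢false (trans (sym s∈x) (x≐∅ s))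

  nonempty⇒inhabited : ∀ x → ¬ x ≐ ∅ → ∃ λ s → ⟦ x ⟧ s ≡ true
  nonempty⇒inhabited x x≉∅ with search (modulus x) (local x)
  ... | inj₁ x-empty = ⊥-elim (x≉∅ x-empty)
  ... | inj₂ s∈x     = s∈x

  splice : ℕ → Point → Bool → Point
  splice zero    s b i       = b
  splice (suc n) s b zero    = s 0
  splice (suc n) s b (suc i) = splice n (s ∘ suc) b i

  splice-agreeBelow : ∀ n s b → AgreeBelow n (splice n s b) s
  splice-agreeBelow (suc n) s b {zero}  _         = refl
  splice-agreeBelow (suc n) s b {suc i} (s≤s i<n) = splice-agreeBelow n (s ∘ suc) b i<n

  splice-at : ∀ n s b → splice n s b n ≡ b
  splice-at zero    s b = refl
  splice-at (suc n) s b = splice-at n (s ∘ suc) b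

  coordinate : ℕ → Clopen
  coordinate n = record { ⟦_⟧ = λ s → s n ; modulus = suc n ; local = λ agree → agree (n<1+n n) }

  clopen-atomless : Atomless
  clopen-atomless x x≉∅ with nonempty⇒inhabited x x≉∅
  ... | s , s∈x = x ∩ coordinate n , half≉∅ , x·y≤x x (coordinate n) , half≉x
    where
    n : ℕ
    n = modulus x

    splice∈x : ∀ b → ⟦ x ⟧ (splice n s b) ≡ true
    splice∈x b = trans (local x (splice-agreeBelow n s b)) s∈x

    half≉∅ : ¬ (x ∩ coordinate n) ≐ ∅
    half≉∅ half≐∅ = true≢false (trans (sym (cong₂ _∧_ (splice∈x true) (splice-at n s true)))
                                      (half≐∅ (splice n s true)))

    half≉x : ¬ (x ∩ coordinate n) ≐ x
    half≉x half≐x = true≢false (trans (sym (splice∈x false))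
                                      (trans (sym (half≐x (splice n s false)))
                                             (cong₂ _∧_ (splice∈x false) (splice-at n s false))))

open ClopenAlgebra using (CantorAlgebra; full≉∅; _≟∅; clopen-atomless)

proposition5p7 : Σ (BooleanAlgebra 0ℓ 0ℓ) λ B → Σ (Rel (BooleanAlgebra.Carrier B) 0ℓ) λ C →
    Contact.IsBCA B C × Contact.Atomless B C × Contact.IA B C × Contact.C5 B C
      × Contact.QW⊆QG B C × ¬ Contact.C6 B C
proposition5p7 =
  CantorAlgebra , Overlap , overlap-isBCA _≟∅ , clopen-atomless , overlap-IA , overlap-C5
  , overlap-QW⊆QG full≉∅ , atomless⇒¬C6 full≉∅ clopen-atomless
  where open OverlapContact CantorAlgebra
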